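{- The category of finite strict double posets is $(\mathrm{RegEpi},\mathrm{Mono})$-structured and $(\mathrm{Epi},\mathrm{RegMono})$-structured.
   Context: A finite strict double poset is a triple $(A,P_A,Q_A)$ with $A$ finite and $P_A,Q_A$ strict partial orders on $A$; morphisms are maps preserving both strict orders. $\mathrm{Mono},\mathrm{Epi}$ are the classes of monomorphisms and epimorphisms; $\mathrm{RegMono}$ the class of regular monomorphisms (equalizers of some parallel pair), $\mathrm{RegEpi}$ the class of regular epimorphisms (coequalizers of some parallel pair). For classes $E,M$ of morphisms, a category is $(E,M)$-structured if (1) $E$ and $M$ are closed under composition with isomorphisms; (2) every morphism $f$ factors as $f=m\circ e$ with $e\in E$, $m\in M$; (3) for every commutative square $g\circ e=m\circ f$ with $e\in E$, $m\in M$ there is a unique morphism $d$ with $d\circ e=f$ and $m\circ d=g$. -}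

module Defs where

open import Data.Nat using (ℕ)
open import Data.Fin using (Fin)
open import Data.Bool using (Bool; true; false)
open import Data.Product using (Σ; _×_; _,_)
open import Relation.Binary.PropositionalEquality using (_≡_)

-- A finite set is represented (up to bijection) as Fin n.  A relation on
-- a finite set is represented by its (Boolean) characteristic function;
-- "x P y" means  P x y ≡ true.

record DPos : Set where
  field
    n       : ℕ
    P       : Fin n → Fin n → Bool
    Q       : Fin n → Fin n → Bool
    P-irrefl : ∀ x → P x x ≡ false
    P-trans  : ∀ {x y z} → P x y ≡ true → P y z ≡ true → P x z ≡ true
    Q-irrefl : ∀ x → Q x x ≡ false
    Q-trans  : ∀ {x y z} → Q x y ≡ true → Q y z ≡ true → Q x z ≡ true

open DPos public

record Hom (A B : DPos) : Set where
  field
    fun   : Fin (n A) → Fin (n B)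
    presP : ∀ {x y} → P A x y ≡ true → P B (fun x) (fun y) ≡ true
    presQ : ∀ {x y} → Q A x y ≡ true → Q B (fun x) (fun y) ≡ true

open Hom public

infix 4 _≈_
_≈_ : ∀ {A B} → Hom A B → Hom A B → Set
f ≈ g = ∀ x → fun f x ≡ fun g x

idH : ∀ {A} → Hom A A
idH = record { fun = λ x → x ; presP = λ p → p ; presQ = λ q → q }

infixr 9 _∘H_
_∘H_ : ∀ {A B C} → Hom B C → Hom A B → Hom A C
g ∘H f = record
  { fun   = λ x → fun g (fun f x)
  ; presP = λ p → presP g (presP f p)
  ; presQ = λ q → presQ g (presQ f q) }

IsIso : ∀ {A B} → Hom A B → Set
IsIso {A} {B} f = Σ (Hom B A) λ g → (g ∘H f ≈ idH) × (f ∘H g ≈ idH)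

Mono : ∀ {A B} → Hom A B → Set
Mono {A} {B} f = ∀ {C} (g h : Hom C A) → f ∘H g ≈ f ∘H h → g ≈ h

Epi : ∀ {A B} → Hom A B → Set
Epi {A} {B} f = ∀ {C} (g h : Hom B C) → g ∘H f ≈ h ∘H f → g ≈ h

IsEqualizer : ∀ {A B C} → Hom A B → Hom B C → Hom B C → Set
IsEqualizer {A} {B} {C} f g h =
  (g ∘H f ≈ h ∘H f) ×
  (∀ {D} (k : Hom D B) → g ∘H k ≈ h ∘H k →
     Σ (Hom D A) λ u → (f ∘H u ≈ k) × (∀ (u' : Hom D A) → f ∘H u' ≈ k → u' ≈ u))

IsCoequalizer : ∀ {A B C} → Hom A B → Hom C A → Hom C A → Set
IsCoequalizer {A} {B} {C} f g h =
  (f ∘H g ≈ f ∘H h) ×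
  (∀ {D} (k : Hom A D) → k ∘H g ≈ k ∘H h →
     Σ (Hom B D) λ u → (u ∘H f ≈ k) × (∀ (u' : Hom B D) → u' ∘H f ≈ k → u' ≈ u))

RegMono : ∀ {A B} → Hom A B → Set
RegMono {A} {B} f = Σ DPos λ C → Σ (Hom B C) λ g → Σ (Hom B C) λ h → IsEqualizer f g h

RegEpi : ∀ {A B} → Hom A B → Set
RegEpi {A} {B} f = Σ DPos λ C → Σ (Hom C A) λ g → Σ (Hom C A) λ h → IsCoequalizer f g h

MorClass : Set₁
MorClass = ∀ {A B} → Hom A B → Set

Structured : MorClass → MorClass → Set
Structured E M =
  (∀ {A B C} (f : Hom A B) (i : Hom B C) → E f → IsIso i → E (i ∘H f)) ×
  (∀ {A B C} (i : Hom C A) (f : Hom A B) → E f → IsIso i → E (f ∘H i)) ×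
  (∀ {A B C} (f : Hom A B) (i : Hom B C) → M f → IsIso i → M (i ∘H f)) ×
  (∀ {A B C} (i : Hom C A) (f : Hom A B) → M f → IsIso i → M (f ∘H i)) ×
  (∀ {A B} (f : Hom A B) →
     Σ DPos λ C → Σ (Hom A C) λ e → Σ (Hom C B) λ m →
       E e × M m × (f ≈ m ∘H e)) ×
  (∀ {A B C D} (e : Hom A B) (m : Hom C D) (f : Hom A C) (g : Hom B D) →
     E e → M m → g ∘H e ≈ m ∘H f →
     Σ (Hom B C) λ d → (d ∘H e ≈ f) × (m ∘H d ≈ g) ×
       (∀ (d' : Hom B C) → d' ∘H e ≈ f → m ∘H d' ≈ g → d' ≈ d))

{-# OPTIONS --safe #-}
module Submission where

-- Every morphism f : A → B factors through its image, which can be ordered in two extreme ways.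
-- With the orders induced from B, f becomes a surjection followed by an order-embedding m, and m
-- is the equalizer of two maps from B into two copies of B (ordered through the folding map)
-- that agree exactly on the image of m. With the transitive closure of the orders pushed forward
-- from A (strict because it lies inside the induced orders), f becomes a quotient map followed
-- by an injection; the quotient map is the coequalizer of the identity and "pick a representative
-- of the fibre", both maps out of the discrete double poset on A. The diagonal fill-ins hold in
-- any category.

open import Defs
open import Data.Bool using (Bool; true; false)
open import Data.Bool.Properties using (T-≡; ¬-not) renaming (_≟_ to _≟ᵇ_)
open import Data.Fin using (Fin; zero; suc; splitAt; _↑ˡ_; _↑ʳ_)
open import Data.Fin.Properties using (any?; all?; suc-injective; splitAt-↑ˡ; splitAt-↑ʳ)
  renaming (_≟_ to _≟ᶠ_)
open import Data.Fin.Subset using (Subset; _∈_)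
open import Data.Fin.Subset.Properties using (anySubset?; _∈?_)
open import Data.Nat using (ℕ; zero; suc; _+_)
open import Data.Product using (Σ; ∃; ∃₂; _×_; _,_; proj₁; proj₂)
open import Data.Sum using ([_,_]′)
open import Data.Vec using (tabulate)
open import Data.Vec.Properties using (lookup∘tabulate; []=⇒lookup; lookup⇒[]=)
open import Function using (id; _∘_; _on_; case_of_; Equivalence)
open import Function.Definitions using (Injective; StrictlySurjective)
open import Level using (0ℓ)
open import Relation.Binary using (Rel; Transitive; _⇒_)
open import Relation.Binary.PropositionalEquality using (_≡_; _≢_; _≗_; refl; sym; trans; cong; subst₂)
open import Relation.Nullary using (Dec; yes; no; contradiction)
open import Relation.Nullary.Decidable
  using (isYes; toWitness; fromWitness; decidable-stable; ¬?; _×-dec_; _→-dec_)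
open import Relation.Unary using (Decidable)

injective⇒Mono : ∀ {A B} (f : Hom A B) → Injective _≡_ _≡_ (fun f) → Mono f
injective⇒Mono f injective g h fg≈fh x = injective (fg≈fh x)

surjective⇒Epi : ∀ {A B} (f : Hom A B) → StrictlySurjective _≡_ (fun f) → Epi f
surjective⇒Epi f surjective g h gf≈hf y with surjective y
... | x , refl = gf≈hf x

IsIso⇒Mono : ∀ {A B} (i : Hom A B) → IsIso i → Mono i
IsIso⇒Mono i (j , ji≈id , _) = injective⇒Mono i λ {x} {y} ix≡iy →
  trans (sym (ji≈id x)) (trans (cong (fun j) ix≡iy) (ji≈id y))

IsIso⇒Epi : ∀ {A B} (i : Hom A B) → IsIso i → Epi i
IsIso⇒Epi i (j , _ , ij≈id) = surjective⇒Epi i λ y → fun j y , ij≈id y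

Mono-∘ : ∀ {A B C} (g : Hom B C) (f : Hom A B) → Mono g → Mono f → Mono (g ∘H f)
Mono-∘ g f mono-g mono-f a b gfa≈gfb = mono-f a b (mono-g (f ∘H a) (f ∘H b) gfa≈gfb)

Epi-∘ : ∀ {A B C} (g : Hom B C) (f : Hom A B) → Epi g → Epi f → Epi (g ∘H f)
Epi-∘ g f epi-g epi-f a b agf≈bgf = epi-g a b (epi-f (a ∘H g) (b ∘H g) agf≈bgf)

iso-∘-Mono : ∀ {A B C} (f : Hom A B) (i : Hom B C) → Mono f → IsIso i → Mono (i ∘H f)
iso-∘-Mono f i mono-f iso = Mono-∘ i f (IsIso⇒Mono i iso) mono-f

Mono-∘-iso : ∀ {A B C} (i : Hom C A) (f : Hom A B) → Mono f → IsIso i → Mono (f ∘H i)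
Mono-∘-iso i f mono-f iso = Mono-∘ f i mono-f (IsIso⇒Mono i iso)

iso-∘-Epi : ∀ {A B C} (f : Hom A B) (i : Hom B C) → Epi f → IsIso i → Epi (i ∘H f)
iso-∘-Epi f i epi-f iso = Epi-∘ i f (IsIso⇒Epi i iso) epi-f

Epi-∘-iso : ∀ {A B C} (i : Hom C A) (f : Hom A B) → Epi f → IsIso i → Epi (f ∘H i)
Epi-∘-iso i f epi-f iso = Epi-∘ f i epi-f (IsIso⇒Epi i iso)

iso-∘-RegEpi : ∀ {A B C} (f : Hom A B) (i : Hom B C) → RegEpi f → IsIso i → RegEpi (i ∘H f)
iso-∘-RegEpi f i (D , g , h , fg≈fh , universal) (j , ji≈id , ij≈id) =
  D , g , h , (λ x → cong (fun i) (fg≈fh x)) , λ k kg≈kh →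
    let (u , uf≈k , unique) = universal k kg≈kh in
    u ∘H j ,
    (λ x → trans (cong (fun u) (ji≈id (fun f x))) (uf≈k x)) ,
    λ u′ u′if≈k y → trans (cong (fun u′) (sym (ij≈id y))) (unique (u′ ∘H i) u′if≈k (fun j y))

RegEpi-∘-iso : ∀ {A B C} (i : Hom C A) (f : Hom A B) → RegEpi f → IsIso i → RegEpi (f ∘H i)
RegEpi-∘-iso i f (D , g , h , fg≈fh , universal) (j , ji≈id , ij≈id) =
  D , j ∘H g , j ∘H h ,
  (λ x → trans (cong (fun f) (ij≈id (fun g x)))
                (trans (fg≈fh x) (sym (cong (fun f) (ij≈id (fun h x)))))) ,
  λ k kjg≈kjh →
    let (u , uf≈kj , unique) = universal (k ∘H j) kjg≈kjh in
    u ,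
    (λ x → trans (uf≈kj (fun i x)) (cong (fun k) (ji≈id x))) ,
    λ u′ u′fi≈k → unique u′ λ a → trans (cong (fun u′ ∘ fun f) (sym (ij≈id a))) (u′fi≈k (fun j a))

iso-∘-RegMono : ∀ {A B C} (f : Hom A B) (i : Hom B C) → RegMono f → IsIso i → RegMono (i ∘H f)
iso-∘-RegMono f i (D , g , h , gf≈hf , universal) (j , ji≈id , ij≈id) =
  D , g ∘H j , h ∘H j ,
  (λ x → trans (cong (fun g) (ji≈id (fun f x)))
                (trans (gf≈hf x) (sym (cong (fun h) (ji≈id (fun f x)))))) ,
  λ k gjk≈hjk →
    let (u , fu≈jk , unique) = universal (j ∘H k) gjk≈hjk in
    u ,
    (λ x → trans (cong (fun i) (fu≈jk x)) (ij≈id (fun k x))) ,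
    λ u′ ifu′≈k → unique u′ λ x → trans (sym (ji≈id (fun f (fun u′ x)))) (cong (fun j) (ifu′≈k x))

RegMono-∘-iso : ∀ {A B C} (i : Hom C A) (f : Hom A B) → RegMono f → IsIso i → RegMono (f ∘H i)
RegMono-∘-iso i f (D , g , h , gf≈hf , universal) (j , ji≈id , ij≈id) =
  D , g , h , (λ x → gf≈hf (fun i x)) , λ k gk≈hk →
    let (u , fu≈k , unique) = universal k gk≈hk in
    j ∘H u ,
    (λ x → trans (cong (fun f) (ij≈id (fun u x))) (fu≈k x)) ,
    λ u′ fiu′≈k x → trans (sym (ji≈id (fun u′ x))) (cong (fun j) (unique (i ∘H u′) fiu′≈k x))

RegEpi⇒Epi : ∀ {A B} (e : Hom A B) → RegEpi e → Epi e
RegEpi⇒Epi e (_ , _ , _ , ep≈eq , universal) g h ge≈he y =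
  let (_ , _ , unique) = universal (g ∘H e) (λ x → cong (fun g) (ep≈eq x)) in
  trans (unique g (λ _ → refl) y) (sym (unique h (λ x → sym (ge≈he x)) y))

RegMono⇒Mono : ∀ {A B} (m : Hom A B) → RegMono m → Mono m
RegMono⇒Mono m (_ , _ , _ , pm≈qm , universal) g h mg≈mh x =
  let (_ , _ , unique) = universal (m ∘H g) (λ y → pm≈qm (fun g y)) in
  trans (unique g (λ _ → refl) x) (sym (unique h (λ y → sym (mg≈mh y)) x))

UniqueDiagonal : ∀ {A B C D} → Hom A B → Hom C D → Hom A C → Hom B D → Set
UniqueDiagonal {B = B} {C = C} e m f g =
  Σ (Hom B C) λ d → (d ∘H e ≈ f) × (m ∘H d ≈ g) × (∀ d′ → d′ ∘H e ≈ f → m ∘H d′ ≈ g → d′ ≈ d)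

RegEpi-Mono-diagonal : ∀ {A B C D} (e : Hom A B) (m : Hom C D) (f : Hom A C) (g : Hom B D) →
                       RegEpi e → Mono m → g ∘H e ≈ m ∘H f → UniqueDiagonal e m f g
RegEpi-Mono-diagonal e m f g regEpi@(_ , p , q , ep≈eq , universal) mono-m ge≈mf =
  let (d , de≈f , unique) = universal f fp≈fq in
  d , de≈f , md≈g d de≈f , λ d′ d′e≈f _ → unique d′ d′e≈f
  where
  fp≈fq : f ∘H p ≈ f ∘H q
  fp≈fq = mono-m (f ∘H p) (f ∘H q) λ x →
    trans (sym (ge≈mf (fun p x))) (trans (cong (fun g) (ep≈eq x)) (ge≈mf (fun q x)))
  md≈g : ∀ d → d ∘H e ≈ f → m ∘H d ≈ g
  md≈g d de≈f = RegEpi⇒Epi e regEpi (m ∘H d) g λ x →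
    trans (cong (fun m) (de≈f x)) (sym (ge≈mf x))

Epi-RegMono-diagonal : ∀ {A B C D} (e : Hom A B) (m : Hom C D) (f : Hom A C) (g : Hom B D) →
                       Epi e → RegMono m → g ∘H e ≈ m ∘H f → UniqueDiagonal e m f g
Epi-RegMono-diagonal e m f g epi-e regMono@(_ , p , q , pm≈qm , universal) ge≈mf =
  let (d , md≈g , unique) = universal g pg≈qg in
  d , de≈f d md≈g , md≈g , λ d′ _ md′≈g → unique d′ md′≈g
  where
  pg≈qg : p ∘H g ≈ q ∘H g
  pg≈qg = epi-e (p ∘H g) (q ∘H g) λ x →
    trans (cong (fun p) (ge≈mf x)) (trans (pm≈qm (fun f x)) (sym (cong (fun q) (ge≈mf x))))
  de≈f : ∀ d → m ∘H d ≈ g → d ∘H e ≈ f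
  de≈f d md≈g = RegMono⇒Mono m regMono (d ∘H e) f λ x → trans (md≈g (fun e x)) (ge≈mf x)

record Enumeration {b : ℕ} (S : Fin b → Set) : Set where
  field
    size            : ℕ
    embed           : Fin size → Fin b
    embed-injective : Injective _≡_ _≡_ embed
    embed-∈         : ∀ i → S (embed i)
    embed-onto      : ∀ {x} → S x → ∃ λ i → embed i ≡ x

enumerate-suc : ∀ {b} {S : Fin (suc b) → Set} →
                Dec (S zero) → Enumeration (S ∘ suc) → Enumeration S
enumerate-suc {b} {S} (yes s₀) E = record
  { size = suc size ; embed = embed′ ; embed-injective = injective
  ; embed-∈ = ∈S ; embed-onto = onto }
  where
  open Enumeration E
  embed′ : Fin (suc size) → Fin (suc b)
  embed′ zero    = zero
  embed′ (suc i) = suc (embed i)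
  injective : Injective _≡_ _≡_ embed′
  injective {zero}  {zero}  _ = refl
  injective {suc i} {suc j} p = cong suc (embed-injective (suc-injective p))
  ∈S : ∀ i → S (embed′ i)
  ∈S zero    = s₀
  ∈S (suc i) = embed-∈ i
  onto : ∀ {x} → S x → ∃ λ i → embed′ i ≡ x
  onto {zero}  _ = zero , refl
  onto {suc x} s = let (i , embed-i≡x) = embed-onto s in suc i , cong suc embed-i≡x
enumerate-suc {S = S} (no ¬s₀) E = record
  { size = size ; embed = suc ∘ embed ; embed-injective = embed-injective ∘ suc-injective
  ; embed-∈ = embed-∈ ; embed-onto = onto }
  where
  open Enumeration E
  onto : ∀ {x} → S x → ∃ λ i → suc (embed i) ≡ x
  onto {zero}  s = case ¬s₀ s of λ ()
  onto {suc x} s = let (i , embed-i≡x) = embed-onto s in i , cong suc embed-i≡x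

enumerate : ∀ {b} {S : Fin b → Set} → Decidable S → Enumeration S
enumerate {zero}  _  = record
  { size = 0 ; embed = λ () ; embed-injective = λ { {()} }
  ; embed-∈ = λ () ; embed-onto = λ { {()} } }
enumerate {suc b} S? = enumerate-suc (S? zero) (enumerate (S? ∘ suc))

record ImageFactorisation {a b : ℕ} (f : Fin a → Fin b) : Set where
  field
    size             : ℕ
    cover            : Fin a → Fin size
    cover-surjective : StrictlySurjective _≡_ cover
    embed            : Fin size → Fin b
    embed-injective  : Injective _≡_ _≡_ embed
    factorises       : embed ∘ cover ≗ f

imageFactorisation : ∀ {a b} (f : Fin a → Fin b) → ImageFactorisation f
imageFactorisation {a} f = record
  { size = size ; cover = cover ; cover-surjective = cover-surjective
  ; embed = embed ; embed-injective = embed-injective ; factorises = factorises }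
  where
  open Enumeration (enumerate λ y → any? λ x → f x ≟ᶠ y)
  cover : Fin a → Fin size
  cover x = proj₁ (embed-onto (x , refl))
  factorises : embed ∘ cover ≗ f
  factorises x = proj₂ (embed-onto (x , refl))
  cover-surjective : StrictlySurjective _≡_ cover
  cover-surjective i =
    let (x , fx≡embed-i) = embed-∈ i in x , embed-injective (trans (factorises x) fx≡embed-i)

⟦_⟧ : ∀ {A : Set} → (A → A → Bool) → Rel A 0ℓ
⟦ R ⟧ x y = R x y ≡ true

⟦⟧-on-≗ : ∀ {A B : Set} (S : B → B → Bool) {f g : A → B} → f ≗ g → ⟦ S on g ⟧ ⇒ ⟦ S on f ⟧
⟦⟧-on-≗ S f≗g {x} {y} = subst₂ ⟦ S ⟧ (sym (f≗g x)) (sym (f≗g y))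

module TransitiveClosure {m : ℕ} {R : Rel (Fin m) 0ℓ} (R? : ∀ i j → Dec (R i j)) where

  Closed : Fin m → Subset m → Set
  Closed i U = (∀ j → R i j → j ∈ U) × (∀ j l → j ∈ U → R j l → l ∈ U)

  -- Reachability as membership in every closed subset: quantifying over the finitely many
  -- subsets of Fin m makes it decidable.
  Reachable : Rel (Fin m) 0ℓ
  Reachable i j = ∀ U → Closed i U → j ∈ U

  Closed? : ∀ i U → Dec (Closed i U)
  Closed? i U = all? (λ j → R? i j →-dec j ∈? U)
          ×-dec all? (λ j → all? λ l → j ∈? U →-dec R? j l →-dec l ∈? U)

  Reachable? : ∀ i j → Dec (Reachable i j)
  Reachable? i j with anySubset? (λ U → Closed? i U ×-dec ¬? (j ∈? U))
  ... | yes (U , closed , j∉U) = no λ reachable → j∉U (reachable U closed)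
  ... | no ∄U = yes λ U closed → decidable-stable (j ∈? U) λ j∉U → ∄U (U , closed , j∉U)

  closure : Fin m → Fin m → Bool
  closure i j = isYes (Reachable? i j)

  toReachable : ⟦ closure ⟧ ⇒ Reachable
  toReachable c = toWitness (Equivalence.from T-≡ c)

  fromReachable : Reachable ⇒ ⟦ closure ⟧
  fromReachable r = Equivalence.to T-≡ (fromWitness r)

  R⇒closure : R ⇒ ⟦ closure ⟧
  R⇒closure r = fromReachable λ U (successors , _) → successors _ r

  closure-trans : Transitive ⟦ closure ⟧
  closure-trans c d = fromReachable λ U closed@(_ , step) →
    toReachable d U ((λ l r → step _ l (toReachable c U closed) r) , step)

  closure-least : ∀ (S : Fin m → Fin m → Bool) → Transitive ⟦ S ⟧ → R ⇒ ⟦ S ⟧ →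
                  ⟦ closure ⟧ ⇒ ⟦ S ⟧
  closure-least S S-trans R⇒S {i} c =
    from-tabulate (toReachable c (tabulate (S i)) (successors , step))
    where
    to-tabulate : ∀ {l} → S i l ≡ true → l ∈ tabulate (S i)
    to-tabulate {l} s = lookup⇒[]= l _ (trans (lookup∘tabulate (S i) l) s)
    from-tabulate : ∀ {l} → l ∈ tabulate (S i) → S i l ≡ true
    from-tabulate {l} l∈ = trans (sym (lookup∘tabulate (S i) l)) ([]=⇒lookup l∈)
    successors : ∀ l → R i l → l ∈ tabulate (S i)
    successors l r = to-tabulate (R⇒S r)
    step : ∀ j l → j ∈ tabulate (S i) → R j l → l ∈ tabulate (S i)
    step j l j∈ r = to-tabulate (S-trans (from-tabulate j∈) (R⇒S r))

Image : ∀ {a k} → (Fin a → Fin k) → (Fin a → Fin a → Bool) → Rel (Fin k) 0ℓ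
Image g R i j = ∃₂ λ x y → g x ≡ i × g y ≡ j × ⟦ R ⟧ x y

Image? : ∀ {a k} (g : Fin a → Fin k) (R : Fin a → Fin a → Bool) → ∀ i j → Dec (Image g R i j)
Image? g R i j = any? λ x → any? λ y → g x ≟ᶠ i ×-dec g y ≟ᶠ j ×-dec R x y ≟ᵇ true

module ImageClosure {a k : ℕ} (g : Fin a → Fin k) (R : Fin a → Fin a → Bool) where
  open TransitiveClosure (Image? g R) public

  closure-⇒ : ∀ {d} (S : Fin d → Fin d → Bool) → Transitive ⟦ S ⟧ →
              (f : Fin a → Fin d) (u : Fin k → Fin d) → u ∘ g ≗ f → ⟦ R ⟧ ⇒ ⟦ S on f ⟧ →
              ⟦ closure ⟧ ⇒ ⟦ S on u ⟧
  closure-⇒ S S-trans f u u∘g≗f R⇒S = closure-least (S on u) S-trans image⇒S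
    where
    image⇒S : Image g R ⇒ ⟦ S on u ⟧
    image⇒S (_ , _ , refl , refl , r) = ⟦⟧-on-≗ S u∘g≗f (R⇒S r)

  closure-irrefl : ∀ {S : Fin k → Fin k → Bool} → (∀ i → S i i ≡ false) → Transitive ⟦ S ⟧ →
                   ⟦ R ⟧ ⇒ ⟦ S on g ⟧ → ∀ i → closure i i ≡ false
  closure-irrefl {S} S-irrefl S-trans R⇒S i = ¬-not λ cᵢᵢ →
    case trans (sym (S-irrefl i)) (closure-⇒ S S-trans g id (λ _ → refl) R⇒S cᵢᵢ) of λ ()

discrete : ℕ → DPos
discrete k = record
  { n = k ; P = λ _ _ → false ; Q = λ _ _ → false
  ; P-irrefl = λ _ → refl ; P-trans = λ () ; Q-irrefl = λ _ → refl ; Q-trans = λ () }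

fromDiscrete : ∀ {k B} → (Fin k → Fin (n B)) → Hom (discrete k) B
fromDiscrete g = record { fun = g ; presP = λ () ; presQ = λ () }

induced : (B : DPos) {k : ℕ} → (Fin k → Fin (n B)) → DPos
induced B m = record
  { n = _ ; P = P B on m ; Q = Q B on m
  ; P-irrefl = P-irrefl B ∘ m ; P-trans = P-trans B
  ; Q-irrefl = Q-irrefl B ∘ m ; Q-trans = Q-trans B }

inclusion : ∀ B {k} (m : Fin k → Fin (n B)) → Hom (induced B m) B
inclusion B m = record { fun = m ; presP = id ; presQ = id }

restrict : ∀ {A B k} {m : Fin k → Fin (n B)} (f : Hom A B) (g : Fin (n A) → Fin k) →
           m ∘ g ≗ fun f → Hom A (induced B m)
restrict {B = B} f g m∘g≗f = record
  { fun = g ; presP = ⟦⟧-on-≗ (P B) m∘g≗f ∘ presP f ; presQ = ⟦⟧-on-≗ (Q B) m∘g≗f ∘ presQ f }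

inclusion-RegMono : ∀ B {k} (m : Fin k → Fin (n B)) → Injective _≡_ _≡_ m →
                    RegMono (inclusion B m)
inclusion-RegMono B {k} m m-injective =
  induced B fold , left , right , left≈right-on-image , universal
  where
  N = n B
  fold : Fin (N + N) → Fin N
  fold = [ id , id ]′ ∘ splitAt N
  inl inr : Fin N → Fin (N + N)
  inl y = y ↑ˡ N
  inr y = N ↑ʳ y
  inl≢inr : ∀ y → inl y ≢ inr y
  inl≢inr y eq =
    case trans (sym (splitAt-↑ˡ N y N)) (trans (cong (splitAt N) eq) (splitAt-↑ʳ N N y)) of λ ()
  inImage? : ∀ y → Dec (∃ λ i → m i ≡ y)
  inImage? y = any? λ i → m i ≟ᶠ y
  select : Fin N → Fin (N + N)
  select y with inImage? y
  ... | yes _ = inl y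
  ... | no _  = inr y
  fold∘inl : fold ∘ inl ≗ id
  fold∘inl y = cong [ id , id ]′ (splitAt-↑ˡ N y N)
  fold∘select : fold ∘ select ≗ id
  fold∘select y with inImage? y
  ... | yes _ = fold∘inl y
  ... | no _  = cong [ id , id ]′ (splitAt-↑ʳ N N y)
  left right : Hom B (induced B fold)
  left  = restrict idH inl fold∘inl
  right = restrict idH select fold∘select
  left≈right-on-image : left ∘H inclusion B m ≈ right ∘H inclusion B m
  left≈right-on-image i with inImage? (m i)
  ... | yes _ = refl
  ... | no ∉image = contradiction (i , refl) ∉image
  agree⇒inImage : ∀ y → inl y ≡ select y → ∃ λ i → m i ≡ y
  agree⇒inImage y agree with inImage? y
  ... | yes ∈image = ∈image
  ... | no _ = contradiction agree (inl≢inr y)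
  universal : ∀ {D} (h : Hom D B) → left ∘H h ≈ right ∘H h →
              Σ (Hom D (induced B m)) λ u →
                (inclusion B m ∘H u ≈ h) × (∀ u′ → inclusion B m ∘H u′ ≈ h → u′ ≈ u)
  universal {D} h agree =
    restrict h u m∘u≗h , m∘u≗h ,
    λ u′ m∘u′≈h x → m-injective (trans (m∘u′≈h x) (sym (m∘u≗h x)))
    where
    u : Fin (n D) → Fin k
    u x = proj₁ (agree⇒inImage (fun h x) (agree x))
    m∘u≗h : m ∘ u ≗ fun h
    m∘u≗h x = proj₂ (agree⇒inImage (fun h x) (agree x))

module _ {A C : DPos} (g : Hom A C) where
  private
    module ClosureP = ImageClosure (fun g) (P A)
    module ClosureQ = ImageClosure (fun g) (Q A)

  coinduced : DPos
  coinduced = record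
    { n = n C ; P = ClosureP.closure ; Q = ClosureQ.closure
    ; P-irrefl = ClosureP.closure-irrefl (P-irrefl C) (P-trans C) (presP g)
    ; P-trans  = ClosureP.closure-trans
    ; Q-irrefl = ClosureQ.closure-irrefl (Q-irrefl C) (Q-trans C) (presQ g)
    ; Q-trans  = ClosureQ.closure-trans }

  toCoinduced : Hom A coinduced
  toCoinduced = record
    { fun   = fun g
    ; presP = λ r → ClosureP.R⇒closure (_ , _ , refl , refl , r)
    ; presQ = λ r → ClosureQ.R⇒closure (_ , _ , refl , refl , r) }

  descend : ∀ {D} (h : Hom A D) (u : Fin (n C) → Fin (n D)) → u ∘ fun g ≗ fun h → Hom coinduced D
  descend {D} h u u∘g≗h = record
    { fun   = u
    ; presP = ClosureP.closure-⇒ (P D) (P-trans D) (fun h) u u∘g≗h (presP h)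
    ; presQ = ClosureQ.closure-⇒ (Q D) (Q-trans D) (fun h) u u∘g≗h (presQ h) }

  fromCoinduced : Hom coinduced C
  fromCoinduced = descend g id (λ _ → refl)

  toCoinduced-RegEpi : StrictlySurjective _≡_ (fun g) → RegEpi toCoinduced
  toCoinduced-RegEpi surjective =
    discrete (n A) , fromDiscrete id , fromDiscrete (s ∘ fun g) ,
    (λ x → sym (g∘s≗id (fun g x))) ,
    λ h h≈h∘s∘g → let h∘s∘g≗h = λ x → sym (h≈h∘s∘g x) in
      descend h (fun h ∘ s) h∘s∘g≗h , h∘s∘g≗h ,
      λ u′ u′∘g≈h c → trans (cong (fun u′) (sym (g∘s≗id c))) (u′∘g≈h (s c))
    where
    s : Fin (n C) → Fin (n A)
    s c = proj₁ (surjective c)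
    g∘s≗id : fun g ∘ s ≗ id
    g∘s≗id c = proj₂ (surjective c)

Factorisation : MorClass → MorClass → ∀ {A B} → Hom A B → Set
Factorisation E M {A} {B} f =
  Σ DPos λ C → Σ (Hom A C) λ e → Σ (Hom C B) λ m → E e × M m × (f ≈ m ∘H e)

module _ {A B : DPos} (f : Hom A B) where
  open ImageFactorisation (imageFactorisation (fun f))

  private
    onto-image : Hom A (induced B embed)
    onto-image = restrict f cover factorises

    into-B : Hom (coinduced onto-image) B
    into-B = inclusion B embed ∘H fromCoinduced onto-image

  Epi-RegMono-factorisation : Factorisation Epi RegMono f
  Epi-RegMono-factorisation =
    induced B embed , onto-image , inclusion B embed ,
    surjective⇒Epi onto-image cover-surjective , inclusion-RegMono B embed embed-injective ,
    sym ∘ factorises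

  RegEpi-Mono-factorisation : Factorisation RegEpi Mono f
  RegEpi-Mono-factorisation =
    coinduced onto-image , toCoinduced onto-image , into-B ,
    toCoinduced-RegEpi onto-image cover-surjective , injective⇒Mono into-B embed-injective ,
    sym ∘ factorises

theoremB11 : Structured RegEpi Mono × Structured Epi RegMono
theoremB11 =
  ( iso-∘-RegEpi , RegEpi-∘-iso , iso-∘-Mono , Mono-∘-iso
  , RegEpi-Mono-factorisation , RegEpi-Mono-diagonal ) ,
  ( iso-∘-Epi , Epi-∘-iso , iso-∘-RegMono , RegMono-∘-iso
  , Epi-RegMono-factorisation , Epi-RegMono-diagonal )
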